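{- For each $k\ge 2$, the most frequent bigrams (length-2 substrings, counted by number of occurrences) of $F_{2k}$ are $\mathtt{ab}$ and $\mathtt{ba}$, and the most frequent bigram of $F_{2k-1}$ is $\mathtt{ab}$ (unique). Also, for each $i\ge 2$ and each $j\ge 3$, the most frequent bigram of $P_i$ and of $Q_j$ is $\mathtt{ab}$.
   Context: Fibonacci words: $F_1=\mathtt{b}$, $F_2=\mathtt{a}$, $F_i=F_{i-1}F_{i-2}$ for $i\ge 3$. Let $\pi$ be the morphism on $\{\mathtt{a},\mathtt{b}\}^*$ with $\pi(\mathtt{a})=\mathtt{ab}$, $\pi(\mathtt{b})=\mathtt{abb}$, and $\theta$ the morphism with $\theta(\mathtt{a})=\mathtt{aab}$, $\theta(\mathtt{b})=\mathtt{ab}$. For $i\ge 1$, $P_i=\pi^{i-1}(\mathtt{a})$ and $Q_i=\theta^{i-1}(\mathtt{a})$. -}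

module Defs where

open import Data.Nat using (ℕ; zero; suc; _≤_)
open import Data.List using (List; []; _∷_; _++_)
open import Data.Product using (_×_; _,_; proj₁; proj₂)
open import Relation.Binary.PropositionalEquality using (_≡_)
open import Relation.Nullary using (Dec; yes; no)

data Letter : Set where
  a b : Letter

_≟L_ : (x y : Letter) → Dec (x ≡ y)
a ≟L a = yes _≡_.refl
a ≟L b = no (λ ())
b ≟L a = no (λ ())
b ≟L b = yes _≡_.refl

Word : Set
Word = List Letter

Bigram : Set
Bigram = Letter × Letter

occ : Bigram → Word → ℕ
occ _ [] = 0
occ p (u ∷ w) = go u w
  where
  go : Letter → Word → ℕ
  go _ [] = 0
  go u (v ∷ w) with proj₁ p ≟L u | proj₂ p ≟L v
  ... | yes _ | yes _ = suc (go v w)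
  ... | _     | _     = go v w

MostFrequent : Word → Bigram → Set
MostFrequent w u = ∀ (v : Bigram) → occ v w ≤ occ u w

-- Fibonacci words: F 1 = b, F 2 = a, F (i) = F (i-1) F (i-2); F 0 is an unused dummy
F : ℕ → Word
F zero = []
F (suc zero) = b ∷ []
F (suc (suc zero)) = a ∷ []
F (suc (suc (suc i))) = F (suc (suc i)) ++ F (suc i)

morph : (Letter → Word) → Word → Word
morph h [] = []
morph h (x ∷ w) = h x ++ morph h w

πL : Letter → Word
πL a = a ∷ b ∷ []
πL b = a ∷ b ∷ b ∷ []

θL : Letter → Word
θL a = a ∷ a ∷ b ∷ []
θL b = a ∷ b ∷ []

iter : ℕ → (Word → Word) → Word → Word
iter zero f w = w
iter (suc n) f w = f (iter n f w)

-- P i = π^(i-1)(a), Q i = θ^(i-1)(a), for i ≥ 1 (index 0 unused)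
P : ℕ → Word
P zero = []
P (suc n) = iter n (morph πL) (a ∷ [])

Q : ℕ → Word
Q zero = []
Q (suc n) = iter n (morph θL) (a ∷ [])

-- Cutting a word between two letters loses exactly the bigram at the cut, and
-- occurrences of ab and ba alternate, so in a word beginning with a the number of
-- ab's exceeds that of ba's by 1 if it ends with b and by 0 if it ends with a.
-- The Fibonacci words F n (n ≥ 3) begin with a, contain no bb and have fewer aa's
-- than ab's; these properties survive F n = F (n-1) F (n-2), whose junction is
-- aa or ba, and F (2k-1) ends with b while F (2k) ends with a.
-- Every image under π and θ has the form a…b with exactly one ab and no ba, so
-- π w and θ w contain |w| ab's and |w| - 1 ba's; the remaining bigram (bb for π,
-- aa for θ) occurs once per b, resp. a, of w, hence fewer than |w| times as soon
-- as w also contains the other letter.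
module Submission where

open import Data.Empty using (⊥-elim)
open import Data.List using ([]; _∷_; _++_; length; filter)
open import Data.List.Membership.Propositional using (_∈_)
open import Data.List.Properties using (++-identityʳ; filter-notAll)
open import Data.List.Relation.Unary.Any as Any using (here; there)
open import Data.Nat using (ℕ; zero; suc; _+_; _*_; _∸_; _≤_; _<_; z≤n; s≤s)
open import Data.Nat.Properties
open import Data.Product using (_×_; _,_; ∃; proj₁; proj₂)
open import Data.Sum using (_⊎_; inj₁; inj₂)
open import Function.Bundles using (_⇔_; mk⇔)
open import Relation.Nullary using (yes; no)
open import Relation.Binary.PropositionalEquality
  using (_≡_; refl; sym; trans; cong; cong₂; subst; subst₂; module ≡-Reasoning)

open import Defs

hit : Bigram → Letter → Letter → ℕ
hit p x y = occ p (x ∷ y ∷ [])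

occ-∷∷ : ∀ p x y w → occ p (x ∷ y ∷ w) ≡ hit p x y + occ p (y ∷ w)
occ-∷∷ p x y w with proj₁ p ≟L x | proj₂ p ≟L y
... | yes _ | yes _ = refl
... | yes _ | no _  = refl
... | no _  | _     = refl

hit≤1 : ∀ p x y → hit p x y ≤ 1
hit≤1 p x y with proj₁ p ≟L x | proj₂ p ≟L y
... | yes _ | yes _ = ≤-refl
... | yes _ | no _  = z≤n
... | no _  | _     = z≤n

hit-·b-·a≡0 : ∀ x y → hit (x , b) y a ≡ 0
hit-·b-·a≡0 a a = refl
hit-·b-·a≡0 a b = refl
hit-·b-·a≡0 b a = refl
hit-·b-·a≡0 b b = refl

lastOf : Letter → Word → Letter
lastOf x []      = x
lastOf x (y ∷ u) = lastOf y u

lastOf-++ : ∀ x u y v → lastOf x (u ++ y ∷ v) ≡ lastOf y v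
lastOf-++ x []      y v = refl
lastOf-++ x (z ∷ u) y v = lastOf-++ z u y v

occ-++ : ∀ p x u y v →
         occ p ((x ∷ u) ++ y ∷ v) ≡ occ p (x ∷ u) + hit p (lastOf x u) y + occ p (y ∷ v)
occ-++ p x []      y v = occ-∷∷ p x y v
occ-++ p x (z ∷ u) y v = begin
  occ p (x ∷ z ∷ u ++ y ∷ v)                 ≡⟨ occ-∷∷ p x z (u ++ y ∷ v) ⟩
  hit p x z + occ p (z ∷ u ++ y ∷ v)          ≡⟨ cong (hit p x z +_) (occ-++ p z u y v) ⟩
  hit p x z + (occ p (z ∷ u) + H + R)         ≡˘⟨ +-assoc (hit p x z) (occ p (z ∷ u) + H) R ⟩
  hit p x z + (occ p (z ∷ u) + H) + R         ≡˘⟨ cong (_+ R) (+-assoc (hit p x z) (occ p (z ∷ u)) H) ⟩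
  hit p x z + occ p (z ∷ u) + H + R           ≡˘⟨ cong (λ n → n + H + R) (occ-∷∷ p x z u) ⟩
  occ p (x ∷ z ∷ u) + H + R                   ∎
  where
  open ≡-Reasoning
  H R : ℕ
  H = hit p (lastOf z u) y
  R = occ p (y ∷ v)

isB : Letter → ℕ
isB a = 0
isB b = 1

ba-ab-balance : ∀ x u → occ (b , a) (x ∷ u) + isB (lastOf x u) ≡ occ (a , b) (x ∷ u) + isB x
ba-ab-balance x []      = refl
ba-ab-balance x (y ∷ u) = begin
  occ (b , a) (x ∷ y ∷ u) + L                    ≡⟨ cong (_+ L) (occ-∷∷ (b , a) x y u) ⟩
  hit (b , a) x y + occ (b , a) (y ∷ u) + L      ≡⟨ +-assoc (hit (b , a) x y) _ L ⟩
  hit (b , a) x y + (occ (b , a) (y ∷ u) + L)    ≡⟨ cong (hit (b , a) x y +_) (ba-ab-balance y u) ⟩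
  hit (b , a) x y + (occ (a , b) (y ∷ u) + isB y) ≡⟨ step x y (occ (a , b) (y ∷ u)) ⟩
  hit (a , b) x y + occ (a , b) (y ∷ u) + isB x  ≡˘⟨ cong (_+ isB x) (occ-∷∷ (a , b) x y u) ⟩
  occ (a , b) (x ∷ y ∷ u) + isB x                ∎
  where
  open ≡-Reasoning
  L : ℕ
  L = isB (lastOf y u)
  step : ∀ x y n → hit (b , a) x y + (n + isB y) ≡ hit (a , b) x y + n + isB x
  step a a n = refl
  step a b n = trans (+-comm n 1) (sym (+-identityʳ (suc n)))
  step b a n = trans (cong suc (+-identityʳ n)) (+-comm 1 n)
  step b b n = refl

mostFrequent⇔ab : ∀ w → occ (a , a) w < occ (a , b) w → occ (b , a) w < occ (a , b) w →
                  occ (b , b) w < occ (a , b) w → ∀ v → MostFrequent w v ⇔ v ≡ (a , b)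
mostFrequent⇔ab w aa<ab ba<ab bb<ab v = mk⇔ (only v) λ { refl → ab-max }
  where
  ab-max : MostFrequent w (a , b)
  ab-max (a , a) = <⇒≤ aa<ab
  ab-max (a , b) = ≤-refl
  ab-max (b , a) = <⇒≤ ba<ab
  ab-max (b , b) = <⇒≤ bb<ab
  only : ∀ v → MostFrequent w v → v ≡ (a , b)
  only (a , a) max = ⊥-elim (<⇒≱ aa<ab (max (a , b)))
  only (a , b) max = refl
  only (b , a) max = ⊥-elim (<⇒≱ ba<ab (max (a , b)))
  only (b , b) max = ⊥-elim (<⇒≱ bb<ab (max (a , b)))

mostFrequent⇔ab⊎ba : ∀ w → occ (a , a) w < occ (a , b) w → occ (b , a) w ≡ occ (a , b) w →
                     occ (b , b) w < occ (a , b) w →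
                     ∀ v → MostFrequent w v ⇔ (v ≡ (a , b) ⊎ v ≡ (b , a))
mostFrequent⇔ab⊎ba w aa<ab ba≡ab bb<ab v = mk⇔ (only v) λ { (inj₁ refl) → ab-max
                                                           ; (inj₂ refl) → ba-max }
  where
  ab-max : MostFrequent w (a , b)
  ab-max (a , a) = <⇒≤ aa<ab
  ab-max (a , b) = ≤-refl
  ab-max (b , a) = ≤-reflexive ba≡ab
  ab-max (b , b) = <⇒≤ bb<ab
  ba-max : MostFrequent w (b , a)
  ba-max v = subst (occ v w ≤_) (sym ba≡ab) (ab-max v)
  only : ∀ v → MostFrequent w v → v ≡ (a , b) ⊎ v ≡ (b , a)
  only (a , a) max = ⊥-elim (<⇒≱ aa<ab (max (a , b)))
  only (a , b) max = inj₁ refl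
  only (b , a) max = inj₂ refl
  only (b , b) max = ⊥-elim (<⇒≱ bb<ab (max (a , b)))

record FibonacciShape (w : Word) (ℓ : Letter) : Set where
  constructor shape
  field
    tail      : Word
    w≡a∷tail  : w ≡ a ∷ tail
    ends-with : lastOf a tail ≡ ℓ
    aa<ab     : occ (a , a) w < occ (a , b) w
    bb≡0      : occ (b , b) w ≡ 0

shape-ba+isB≡ab : ∀ {w ℓ} → FibonacciShape w ℓ → occ (b , a) w + isB ℓ ≡ occ (a , b) w
shape-ba+isB≡ab (shape u refl refl _ _) = trans (ba-ab-balance a u) (+-identityʳ _)

shape-++ : ∀ {w w′ ℓ ℓ′} → FibonacciShape w ℓ → FibonacciShape w′ ℓ′ → FibonacciShape (w ++ w′) ℓ′
shape-++ (shape u refl _ aa<ab₁ bb≡0₁) (shape v refl v-ends aa<ab₂ bb≡0₂) =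
  shape (u ++ a ∷ v) refl (trans (lastOf-++ a u a v) v-ends) aa<ab bb≡0
  where
  B : Letter
  B = lastOf a u
  aa<ab : occ (a , a) ((a ∷ u) ++ a ∷ v) < occ (a , b) ((a ∷ u) ++ a ∷ v)
  aa<ab = begin-strict
    occ (a , a) ((a ∷ u) ++ a ∷ v)                         ≡⟨ occ-++ (a , a) a u a v ⟩
    occ (a , a) (a ∷ u) + hit (a , a) B a + occ (a , a) (a ∷ v)
      <⟨ +-mono-≤-< (m<n⇒m+h≤n+0 aa<ab₁ (hit≤1 (a , a) B a)) aa<ab₂ ⟩
    occ (a , b) (a ∷ u) + 0 + occ (a , b) (a ∷ v)
      ≡˘⟨ cong (λ n → occ (a , b) (a ∷ u) + n + occ (a , b) (a ∷ v)) (hit-·b-·a≡0 a B) ⟩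
    occ (a , b) (a ∷ u) + hit (a , b) B a + occ (a , b) (a ∷ v)
      ≡˘⟨ occ-++ (a , b) a u a v ⟩
    occ (a , b) ((a ∷ u) ++ a ∷ v)                         ∎
    where
    open ≤-Reasoning
    m<n⇒m+h≤n+0 : ∀ {m n h} → m < n → h ≤ 1 → m + h ≤ n + 0
    m<n⇒m+h≤n+0 {m} {n} {h} m<n h≤1 = begin
      m + h  ≤⟨ +-monoʳ-≤ m h≤1 ⟩
      m + 1  ≡⟨ +-comm m 1 ⟩
      suc m  ≤⟨ m<n ⟩
      n      ≡˘⟨ +-identityʳ n ⟩
      n + 0  ∎
  bb≡0 : occ (b , b) ((a ∷ u) ++ a ∷ v) ≡ 0
  bb≡0 = begin
    occ (b , b) ((a ∷ u) ++ a ∷ v)                         ≡⟨ occ-++ (b , b) a u a v ⟩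
    occ (b , b) (a ∷ u) + hit (b , b) B a + occ (b , b) (a ∷ v)
      ≡⟨ cong₂ _+_ (cong₂ _+_ bb≡0₁ (hit-·b-·a≡0 b B)) bb≡0₂ ⟩
    0                                                      ∎
    where open ≡-Reasoning

fibonacci-shape : ∀ m → FibonacciShape (F (3 + 2 * m)) b × FibonacciShape (F (4 + 2 * m)) a
fibonacci-shape 0 = shape (b ∷ []) refl refl (s≤s z≤n) refl , shape (b ∷ a ∷ []) refl refl (s≤s z≤n) refl
fibonacci-shape (suc m) rewrite *-suc 2 m with fibonacci-shape m
... | odd , even = shape-++ even odd , shape-++ (shape-++ even odd) even

shape-bb<ab : ∀ {w ℓ} → FibonacciShape w ℓ → occ (b , b) w < occ (a , b) w
shape-bb<ab s rewrite FibonacciShape.bb≡0 s = ≤-trans (s≤s z≤n) (FibonacciShape.aa<ab s)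

F-odd-mostFrequent : ∀ m v → MostFrequent (F (3 + 2 * m)) v ⇔ v ≡ (a , b)
F-odd-mostFrequent m = mostFrequent⇔ab (F (3 + 2 * m)) (aa<ab odd) ba<ab (shape-bb<ab odd)
  where
  odd : FibonacciShape (F (3 + 2 * m)) b
  odd = proj₁ (fibonacci-shape m)
  open FibonacciShape
  ba<ab : occ (b , a) (F (3 + 2 * m)) < occ (a , b) (F (3 + 2 * m))
  ba<ab = ≤-reflexive (trans (+-comm 1 _) (shape-ba+isB≡ab odd))

F-even-mostFrequent : ∀ m v → MostFrequent (F (4 + 2 * m)) v ⇔ (v ≡ (a , b) ⊎ v ≡ (b , a))
F-even-mostFrequent m = mostFrequent⇔ab⊎ba (F (4 + 2 * m)) (aa<ab even) ba≡ab (shape-bb<ab even)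
  where
  even : FibonacciShape (F (4 + 2 * m)) a
  even = proj₂ (fibonacci-shape m)
  open FibonacciShape
  ba≡ab : occ (b , a) (F (4 + 2 * m)) ≡ occ (a , b) (F (4 + 2 * m))
  ba≡ab = trans (sym (+-identityʳ _)) (shape-ba+isB≡ab even)

F-mostFrequent : ∀ k → 2 ≤ k →
    (∀ v → MostFrequent (F (2 * k)) v ⇔ (v ≡ (a , b) ⊎ v ≡ (b , a)))
  × (∀ v → MostFrequent (F (2 * k ∸ 1)) v ⇔ v ≡ (a , b))
F-mostFrequent (suc (suc m)) (s≤s (s≤s _)) =
  subst (λ n → ∀ v → MostFrequent (F n) v ⇔ (v ≡ (a , b) ⊎ v ≡ (b , a)))
        (sym 2k≡4+2m) (F-even-mostFrequent m) ,
  subst (λ n → ∀ v → MostFrequent (F n) v ⇔ v ≡ (a , b))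
        (sym (cong (_∸ 1) 2k≡4+2m)) (F-odd-mostFrequent m)
  where
  2k≡4+2m : 2 * (2 + m) ≡ 4 + 2 * m
  2k≡4+2m = *-distribˡ-+ 2 2 m

ABFramed : (Letter → Word) → Set
ABFramed h = ∀ x → ∃ λ u → h x ≡ a ∷ u × lastOf a u ≡ b

module _ {h : Letter → Word} (framed : ABFramed h) where

  occ-morph-∷∷ : ∀ p x y w →
                 occ p (morph h (x ∷ y ∷ w)) ≡ occ p (h x) + hit p b a + occ p (morph h (y ∷ w))
  occ-morph-∷∷ p x y w with h x | framed x | h y | framed y
  ... | .(a ∷ u) | u , refl , u-ends | .(a ∷ v) | v , refl , _ rewrite sym u-ends =
    occ-++ p a u a (v ++ morph h w)

  occ-morph-recurrence : ∀ p (g : Letter → Word → ℕ) →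
    (∀ x → occ p (h x) ≡ g x []) →
    (∀ x y w → occ p (h x) + hit p b a + g y w ≡ g x (y ∷ w)) →
    ∀ x w → occ p (morph h (x ∷ w)) ≡ g x w
  occ-morph-recurrence p g base step x [] = trans (cong (occ p) (++-identityʳ (h x))) (base x)
  occ-morph-recurrence p g base step x (y ∷ w) = begin
    occ p (morph h (x ∷ y ∷ w))                       ≡⟨ occ-morph-∷∷ p x y w ⟩
    occ p (h x) + hit p b a + occ p (morph h (y ∷ w))
      ≡⟨ cong (occ p (h x) + hit p b a +_) (occ-morph-recurrence p g base step y w) ⟩
    occ p (h x) + hit p b a + g y w                   ≡⟨ step x y w ⟩
    g x (y ∷ w)                                       ∎
    where open ≡-Reasoning

  iter-morph-a : ∀ n → ∃ λ u → iter n (morph h) (a ∷ []) ≡ a ∷ u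
  iter-morph-a zero = [] , refl
  iter-morph-a (suc n) with iter-morph-a n | framed a
  ... | u , iter≡a∷u | v , ha≡a∷v , _ =
    v ++ morph h u , trans (cong (morph h) iter≡a∷u) (cong (_++ morph h u) ha≡a∷v)

  occ-morph-ab : (∀ x → occ (a , b) (h x) ≡ 1) → ∀ x w → occ (a , b) (morph h (x ∷ w)) ≡ length (x ∷ w)
  occ-morph-ab one = occ-morph-recurrence (a , b) (λ x w → length (x ∷ w)) one step
    where
    step : ∀ x y w → occ (a , b) (h x) + 0 + length (y ∷ w) ≡ length (x ∷ y ∷ w)
    step x y w rewrite one x = refl

  occ-morph-ba : (∀ x → occ (b , a) (h x) ≡ 0) → ∀ x w → occ (b , a) (morph h (x ∷ w)) ≡ length w
  occ-morph-ba none = occ-morph-recurrence (b , a) (λ _ w → length w) none step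
    where
    step : ∀ x y w → occ (b , a) (h x) + 1 + length w ≡ length (y ∷ w)
    step x y w rewrite none x = refl

  occ-morph≡0 : ∀ p → (∀ x → occ p (h x) ≡ 0) → hit p b a ≡ 0 →
                ∀ x w → occ p (morph h (x ∷ w)) ≡ 0
  occ-morph≡0 p none no-ba = occ-morph-recurrence p (λ _ _ → 0) none step
    where
    step : ∀ x (y : Letter) (w : Word) → occ p (h x) + hit p b a + 0 ≡ 0
    step x _ _ = cong₂ (λ m n → m + n + 0) (none x) no-ba

π-framed : ABFramed πL
π-framed a = b ∷ [] , refl , refl
π-framed b = b ∷ b ∷ [] , refl , refl

θ-framed : ABFramed θL
θ-framed a = a ∷ b ∷ [] , refl , refl
θ-framed b = b ∷ [] , refl , refl

π-occ-aa : ∀ x w → occ (a , a) (morph πL (x ∷ w)) ≡ 0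
π-occ-aa = occ-morph≡0 π-framed (a , a) (λ { a → refl ; b → refl }) refl

π-occ-ab : ∀ x w → occ (a , b) (morph πL (x ∷ w)) ≡ length (x ∷ w)
π-occ-ab = occ-morph-ab π-framed (λ { a → refl ; b → refl })

π-occ-ba : ∀ x w → occ (b , a) (morph πL (x ∷ w)) ≡ length w
π-occ-ba = occ-morph-ba π-framed (λ { a → refl ; b → refl })

π-occ-bb : ∀ x w → occ (b , b) (morph πL (x ∷ w)) ≡ length (filter (_≟L b) (x ∷ w))
π-occ-bb = occ-morph-recurrence π-framed (b , b) (λ x w → length (filter (_≟L b) (x ∷ w)))
  (λ { a → refl ; b → refl }) (λ { a _ _ → refl ; b _ _ → refl })

θ-occ-aa : ∀ x w → occ (a , a) (morph θL (x ∷ w)) ≡ length (filter (_≟L a) (x ∷ w))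
θ-occ-aa = occ-morph-recurrence θ-framed (a , a) (λ x w → length (filter (_≟L a) (x ∷ w)))
  (λ { a → refl ; b → refl }) (λ { a _ _ → refl ; b _ _ → refl })

θ-occ-ab : ∀ x w → occ (a , b) (morph θL (x ∷ w)) ≡ length (x ∷ w)
θ-occ-ab = occ-morph-ab θ-framed (λ { a → refl ; b → refl })

θ-occ-ba : ∀ x w → occ (b , a) (morph θL (x ∷ w)) ≡ length w
θ-occ-ba = occ-morph-ba θ-framed (λ { a → refl ; b → refl })

θ-occ-bb : ∀ x w → occ (b , b) (morph θL (x ∷ w)) ≡ 0
θ-occ-bb = occ-morph≡0 θ-framed (b , b) (λ { a → refl ; b → refl }) refl

π-image-mostFrequent : ∀ u v → MostFrequent (morph πL (a ∷ u)) v ⇔ v ≡ (a , b)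
π-image-mostFrequent u = mostFrequent⇔ab (morph πL (a ∷ u))
  (subst₂ _<_ (sym (π-occ-aa a u)) (sym (π-occ-ab a u)) (s≤s z≤n))
  (subst₂ _<_ (sym (π-occ-ba a u)) (sym (π-occ-ab a u)) ≤-refl)
  (subst₂ _<_ (sym (π-occ-bb a u)) (sym (π-occ-ab a u)) (filter-notAll (_≟L b) (a ∷ u) (here λ ())))

θ-image-mostFrequent : ∀ x u → b ∈ x ∷ u → ∀ v → MostFrequent (morph θL (x ∷ u)) v ⇔ v ≡ (a , b)
θ-image-mostFrequent x u b∈x∷u = mostFrequent⇔ab (morph θL (x ∷ u))
  (subst₂ _<_ (sym (θ-occ-aa x u)) (sym (θ-occ-ab x u))
    (filter-notAll (_≟L a) (x ∷ u) (Any.map (λ { refl () }) b∈x∷u)))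
  (subst₂ _<_ (sym (θ-occ-ba x u)) (sym (θ-occ-ab x u)) ≤-refl)
  (subst₂ _<_ (sym (θ-occ-bb x u)) (sym (θ-occ-ab x u)) (s≤s z≤n))

P-mostFrequent : ∀ i → 2 ≤ i → ∀ v → MostFrequent (P i) v ⇔ v ≡ (a , b)
P-mostFrequent (suc (suc n)) (s≤s (s≤s _)) with iter-morph-a π-framed n
... | u , iter≡a∷u rewrite iter≡a∷u = π-image-mostFrequent u

Q-mostFrequent : ∀ j → 3 ≤ j → ∀ v → MostFrequent (Q j) v ⇔ v ≡ (a , b)
Q-mostFrequent (suc (suc (suc n))) (s≤s (s≤s (s≤s _))) with iter-morph-a θ-framed n
... | u , iter≡a∷u rewrite iter≡a∷u =
  θ-image-mostFrequent a (a ∷ b ∷ morph θL u) (there (there (here refl)))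

lemma1 : (∀ (k : ℕ) → 2 ≤ k →
              (∀ (v : Bigram) → MostFrequent (F (2 * k)) v ⇔ (v ≡ (a , b) ⊎ v ≡ (b , a)))
            × (∀ (v : Bigram) → MostFrequent (F (2 * k ∸ 1)) v ⇔ v ≡ (a , b)))
         × (∀ (i : ℕ) → 2 ≤ i → ∀ (v : Bigram) → MostFrequent (P i) v ⇔ v ≡ (a , b))
         × (∀ (j : ℕ) → 3 ≤ j → ∀ (v : Bigram) → MostFrequent (Q j) v ⇔ v ≡ (a , b))
lemma1 = F-mostFrequent , P-mostFrequent , Q-mostFrequent
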